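{- Let $p,q>1$ be relatively prime integers. For each integer $n\ge\max(p,q)$, $H(n,p,q)\le H^d(n,p,q)$.
   Context: A partial word is a sequence over $\Sigma\cup\{\diamondsuit\}$, where $\diamondsuit\notin\Sigma$ is a hole. For $a,b\in\Sigma\cup\{\diamondsuit\}$, $a\approx b$ if $a=b$ or one of them is $\diamondsuit$. A positive integer $r$ is a (strong) period of $X$ if there is $P\in\Sigma^r$ with $X[i]\approx P[i\bmod r]$ for all positions $i$. $H(n,p,q)$ is the minimum number of holes in a partial word of length $n$ with periods $p$ and $q$ but not period $\gcd(p,q)$. A partial word $S$ of length $n\ge\max(p,q)$ is $(p,q)$-special if there is a position $l$ such that for every position $i$: $S[i]=\mathsf a$ if $p\nmid(l-i)$ and $q\nmid(l-i)$; $S[i]=\mathsf b$ if $p\mid(l-i)$ and $q\mid(l-i)$; $S[i]=\diamondsuit$ otherwise ($\mathsf a\ne\mathsf b$ letters). $H^d(n,p,q)$ is the minimum number of holes in a $(p,q)$-special partial word of length $n$. -}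

module Defs where

open import Data.Nat using (ℕ; zero; suc; _+_)
open import Data.Nat.DivMod using (_mod_)
open import Data.Fin using (Fin; toℕ)
import Data.Fin as F
open import Data.Maybe using (Maybe; just; nothing)
open import Data.Unit using (⊤)
open import Data.Empty using (⊥)
open import Data.Product using (Σ; Σ-syntax; ∃-syntax; _×_)
open import Relation.Nullary using (¬_)
open import Relation.Binary.PropositionalEquality using (_≡_)
open import Data.Integer using (ℤ; +_; _-_)
import Data.Integer.Divisibility as ℤD

-- A partial word of length n over alphabet A: `nothing` is the hole ◇.
PWord : Set → ℕ → Set
PWord A n = Fin n → Maybe A

Compat : {A : Set} → Maybe A → A → Set
Compat nothing  _ = ⊤
Compat (just x) a = x ≡ a

HasPeriod : {A : Set} {n : ℕ} → ℕ → PWord A n → Set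
HasPeriod zero    X = ⊥
HasPeriod {A} (suc r) X =
  Σ[ P ∈ (Fin (suc r) → A) ] (∀ i → Compat (X i) (P (toℕ i mod suc r)))

holes : {A : Set} {n : ℕ} → PWord A n → ℕ
holes {n = zero}  X = 0
holes {n = suc n} X with X F.zero
... | nothing = suc (holes (λ i → X (F.suc i)))
... | just _  = holes (λ i → X (F.suc i))

Div : {n : ℕ} → ℕ → Fin n → Fin n → Set
Div {n} d l i = (+ d) ℤD.∣ ((+ toℕ l) - (+ toℕ i))

SpecialWith : {A : Set} {n : ℕ} → ℕ → ℕ → A → A → Fin n → PWord A n → Set
SpecialWith p q a b l S = ∀ i →
    ((¬ Div p l i × ¬ Div q l i) → S i ≡ just a)
  × ((Div p l i × Div q l i) → S i ≡ just b)
  × ((Div p l i × ¬ Div q l i) → S i ≡ nothing)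
  × ((¬ Div p l i × Div q l i) → S i ≡ nothing)

-- (p,q)-special partial word (length condition n ≥ max(p,q) imposed separately).
Special : {A : Set} {n : ℕ} → ℕ → ℕ → PWord A n → Set
Special {A} {n} p q S =
  Σ[ a ∈ A ] Σ[ b ∈ A ] (¬ a ≡ b) × (Σ[ l ∈ Fin n ] SpecialWith p q a b l S)

module Submission where

-- H(n,p,q) ≤ H^d(n,p,q): the witness for H is the special word S itself.
--
-- Let S be (p,q)-special with letters a ≠ b and centre l.  Every letter of S
-- sits at a position i where p and q either both divide l - i (letter b) or
-- both do not (letter a); positions where exactly one divides are holes.
-- Hence, for d ∈ {p, q}, S is compatible with the full word "b on the residue
-- class of l mod d, a elsewhere", which depends only on residues mod d, so S
-- has period d.  Since gcd(p,q) = 1, it remains to see that S does not have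
-- period 1: S carries b at l and a at a neighbour of l (distance 1 is not
-- divisible by p, q > 1), while period 1 forces all letters to be equal.

open import Defs
open import Data.Nat.Base
  using (ℕ; zero; suc; _+_; _*_; _∸_; _%_; _/_; _⊔_; _≤_; _<_; NonZero; >-nonZero; z<s)
open import Data.Nat.Properties
  using (≤-total; ≤-refl; ≤-trans; <-trans; <⇒≢; n<1+n; n≤1+n; m≤m⊔n; +-comm; +-assoc;
         +-cancelˡ-≡; m+n∸n≡m; m∸n+n≡m; _≟_)
open import Data.Nat.Divisibility using (_∣_; _∣0; n∣m*n; ∣m+n∣m⇒∣n; ∣1⇒≡1)
open import Data.Nat.DivMod using (_mod_; m≡m%n+[m/n]*n; m%n%n≡m%n; %-remove-+ˡ; m%n<n)
open import Data.Nat.GCD using (gcd)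
open import Data.Nat.Coprimality using (Coprime; coprime⇒gcd≡1)
open import Data.Integer.Base using (+_; _⊖_; ∣_∣)
open import Data.Integer.Properties using ([+m]-[+n]≡m⊖n; ∣m⊖n∣≡∣n⊖m∣; ∣⊖∣-≤; n⊖n≡0)
open import Data.Fin.Base using (Fin; zero; toℕ; fromℕ<)
open import Data.Fin.Properties using (toℕ-fromℕ<; toℕ<n)
open import Data.Maybe.Base using (just)
open import Data.Unit.Base using (tt)
open import Data.Bool.Base using (if_then_else_)
open import Data.Sum.Base using (inj₁; inj₂)
open import Data.Product.Base using (Σ-syntax; _×_; _,_; swap)
open import Function.Base using (_∘_)
open import Function.Bundles using (_⇔_; mk⇔; Equivalence)
open import Relation.Nullary using (¬_)
open import Relation.Nullary.Decidable using (Dec; yes; no; does; dec-true; dec-false)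
import Relation.Nullary.Decidable as Dec
open import Relation.Binary.PropositionalEquality
  using (_≡_; refl; sym; trans; cong; subst; subst₂; module ≡-Reasoning)

open Equivalence using (to; from)

shift-congruence : ∀ d .{{_ : NonZero d}} k m → d ∣ k ⇔ ((k + m) % d ≡ m % d)
shift-congruence d k m = mk⇔ (%-remove-+ˡ m) reflect
  where
  reflect : (k + m) % d ≡ m % d → d ∣ k
  reflect same = ∣m+n∣m⇒∣n (subst (d ∣_) quotients (n∣m*n ((k + m) / d))) (n∣m*n (m / d))
    where
    open ≡-Reasoning
    -- write k + m and m by division with remainder; the remainders agree
    quotients : (k + m) / d * d ≡ m / d * d + k
    quotients = +-cancelˡ-≡ (m % d) _ _ (begin
      m % d + (k + m) / d * d         ≡⟨ cong (_+ (k + m) / d * d) same ⟨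
      (k + m) % d + (k + m) / d * d   ≡⟨ m≡m%n+[m/n]*n (k + m) d ⟨
      k + m                           ≡⟨ +-comm k m ⟩
      m + k                           ≡⟨ cong (_+ k) (m≡m%n+[m/n]*n m d) ⟩
      m % d + m / d * d + k           ≡⟨ +-assoc (m % d) (m / d * d) k ⟩
      m % d + (m / d * d + k)         ∎)

ordered-distance-congruence : ∀ d .{{_ : NonZero d}} {m n} → n ≤ m →
                              d ∣ ∣ m ⊖ n ∣ ⇔ (m % d ≡ n % d)
ordered-distance-congruence d {m} {n} n≤m =
  subst₂ (λ δ t → d ∣ δ ⇔ (t % d ≡ n % d))
    (sym (trans (∣m⊖n∣≡∣n⊖m∣ m n) (∣⊖∣-≤ n≤m))) (m∸n+n≡m n≤m)
    (shift-congruence d (m ∸ n) n)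

distance-congruence : ∀ d .{{_ : NonZero d}} m n → d ∣ ∣ m ⊖ n ∣ ⇔ (m % d ≡ n % d)
distance-congruence d m n with ≤-total n m
... | inj₁ n≤m = ordered-distance-congruence d n≤m
... | inj₂ m≤n = mk⇔ (sym ∘ to flipped ∘ subst (d ∣_) (∣m⊖n∣≡∣n⊖m∣ m n))
                     (subst (d ∣_) (∣m⊖n∣≡∣n⊖m∣ n m) ∘ from flipped ∘ sym)
  where
  flipped : d ∣ ∣ n ⊖ m ∣ ⇔ (n % d ≡ m % d)
  flipped = ordered-distance-congruence d m≤n

Div≡distance : ∀ {n} d (l i : Fin n) → Div d l i ≡ (d ∣ ∣ toℕ l ⊖ toℕ i ∣)
Div≡distance d l i = cong (λ z → d ∣ ∣ z ∣) ([+m]-[+n]≡m⊖n (toℕ l) (toℕ i))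

Div⇒distance : ∀ {n} d (l i : Fin n) → Div d l i → d ∣ ∣ toℕ l ⊖ toℕ i ∣
Div⇒distance d l i = subst (λ T → T) (Div≡distance d l i)

Div⇔congruent : ∀ {n} d .{{_ : NonZero d}} (l i : Fin n) →
                Div d l i ⇔ (toℕ l % d ≡ toℕ i % d)
Div⇔congruent d l i = subst (λ T → T ⇔ (toℕ l % d ≡ toℕ i % d)) (sym (Div≡distance d l i))
  (distance-congruence d (toℕ l) (toℕ i))

Div? : ∀ {n} d .{{_ : NonZero d}} (l i : Fin n) → Dec (Div d l i)
Div? d l i = Dec.map′ (from congruent) (to congruent) (toℕ l % d ≟ toℕ i % d)
  where
  congruent : Div d l i ⇔ (toℕ l % d ≡ toℕ i % d)
  congruent = Div⇔congruent d l i

Div-refl : ∀ {n} d (l : Fin n) → Div d l l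
Div-refl d l = subst (λ T → T) (sym (Div≡distance d l l))
  (subst (λ z → d ∣ ∣ z ∣) (sym (n⊖n≡0 (toℕ l))) (d ∣0))

residue-word⇒period : ∀ {A n} d .{{_ : NonZero d}} (X : PWord A n) (w : ℕ → A) →
  (∀ m → w (m % d) ≡ w m) → (∀ i → Compat (X i) (w (toℕ i))) → HasPeriod d X
residue-word⇒period d@(suc _) X w residue compat = (λ j → w (toℕ j)) , λ i →
  subst (Compat (X i)) (sym (reduce i)) (compat i)
  where
  reduce : ∀ i → w (toℕ (toℕ i mod d)) ≡ w (toℕ i)
  reduce i = trans (cong w (toℕ-fromℕ< (m%n<n (toℕ i) d))) (residue (toℕ i))

marker : {A : Set} (d : ℕ) .{{_ : NonZero d}} (c : ℕ) (a b : A) → ℕ → A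
marker d c a b m = if does (c % d ≟ m % d) then b else a

marker-residue : ∀ {A} d .{{_ : NonZero d}} c (a b : A) m →
                 marker d c a b (m % d) ≡ marker d c a b m
marker-residue d c a b m = cong (λ r → if does (c % d ≟ r) then b else a) (m%n%n≡m%n m d)

marker-congruent : ∀ {A} d .{{_ : NonZero d}} {c m} (a b : A) →
                   c % d ≡ m % d → marker d c a b m ≡ b
marker-congruent d {c} {m} a b eq = cong (if_then b else a) (dec-true (c % d ≟ m % d) eq)

marker-incongruent : ∀ {A} d .{{_ : NonZero d}} {c m} (a b : A) →
                     ¬ (c % d ≡ m % d) → marker d c a b m ≡ a
marker-incongruent d {c} {m} a b neq = cong (if_then b else a) (dec-false (c % d ≟ m % d) neq)

period1⇒constant : ∀ {A n} (X : PWord A n) → HasPeriod 1 X →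
                   ∀ {i j x y} → X i ≡ just x → X j ≡ just y → x ≡ y
period1⇒constant X (P , compat) {i} {j} Xi Xj = begin
  _  ≡⟨ subst (λ s → Compat s (P (toℕ i mod 1))) Xi (compat i) ⟩
  P (toℕ i mod 1)  ≡⟨ cong P (Fin1-unique _ _) ⟩
  P (toℕ j mod 1)  ≡⟨ subst (λ s → Compat s (P (toℕ j mod 1))) Xj (compat j) ⟨
  _  ∎
  where
  open ≡-Reasoning
  Fin1-unique : (u v : Fin 1) → u ≡ v
  Fin1-unique zero zero = refl

neighbour : ∀ {n} → 2 ≤ n → (l : Fin n) → Σ[ j ∈ Fin n ] ∣ toℕ l ⊖ toℕ j ∣ ≡ 1
neighbour {n} 2≤n l = step (toℕ l) (toℕ<n l)
  where
  step : ∀ m → m < n → Σ[ j ∈ Fin n ] ∣ m ⊖ toℕ j ∣ ≡ 1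
  step zero    _   = fromℕ< 2≤n , cong (λ t → ∣ 0 ⊖ t ∣) (toℕ-fromℕ< 2≤n)
  step (suc m) m<n = fromℕ< m'<n ,
    trans (cong (λ t → ∣ suc m ⊖ t ∣) (toℕ-fromℕ< m'<n))
          (trans (∣m⊖n∣≡∣n⊖m∣ (suc m) m) (trans (∣⊖∣-≤ (n≤1+n m)) (m+n∸n≡m 1 m)))
    where
    m'<n : m < n
    m'<n = <-trans (n<1+n m) m<n

¬Div-at-distance-1 : ∀ {n d} (l j : Fin n) → 1 < d → ∣ toℕ l ⊖ toℕ j ∣ ≡ 1 → ¬ Div d l j
¬Div-at-distance-1 {d = d} l j 1<d dist div =
  <⇒≢ 1<d (sym (∣1⇒≡1 (subst (d ∣_) dist (Div⇒distance d l j div))))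

module _ {A : Set} {n : ℕ} {p q : ℕ} {a b : A} {l : Fin n} {S : PWord A n} where

  special-swap : SpecialWith p q a b l S → SpecialWith q p a b l S
  special-swap sp i with sp i
  ... | both-not , both , only-p , only-q =
    both-not ∘ swap , both ∘ swap , only-q ∘ swap , only-p ∘ swap

  -- Every letter of a special word agrees with the marker of l mod p: b on the
  -- class of l (where q must divide too), a off it (where q must not divide).
  special-compat : .{{_ : NonZero p}} .{{_ : NonZero q}} → SpecialWith p q a b l S →
                   ∀ i → Compat (S i) (marker p (toℕ l) a b (toℕ i))
  special-compat sp i with sp i | Div? p l i | Div? q l i
  ... | _ , both , _ , _ | yes dp | yes dq rewrite both (dp , dq) =
    sym (marker-congruent p a b (to (Div⇔congruent p l i) dp))
  ... | _ , _ , only-p , _ | yes dp | no ¬dq rewrite only-p (dp , ¬dq) = tt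
  ... | _ , _ , _ , only-q | no ¬dp | yes dq rewrite only-q (¬dp , dq) = tt
  ... | both-not , _ , _ , _ | no ¬dp | no ¬dq rewrite both-not (¬dp , ¬dq) =
    sym (marker-incongruent p a b (¬dp ∘ from (Div⇔congruent p l i)))

  special⇒period : .{{_ : NonZero p}} .{{_ : NonZero q}} → SpecialWith p q a b l S →
                   HasPeriod p S
  special⇒period sp = residue-word⇒period p S (marker p (toℕ l) a b)
    (marker-residue p (toℕ l) a b) (special-compat sp)

  special-two-letters : 1 < p → 1 < q → 2 ≤ n → SpecialWith p q a b l S →
                        Σ[ j ∈ Fin n ] (S l ≡ just b × S j ≡ just a)
  special-two-letters 1<p 1<q 2≤n sp with neighbour 2≤n l
  ... | j , distance-1 with sp l | sp j
  ...   | _ , both , _ , _ | both-not , _ , _ , _ =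
    j , both (Div-refl p l , Div-refl q l) ,
        both-not (¬Div-at-distance-1 l j 1<p distance-1 , ¬Div-at-distance-1 l j 1<q distance-1)

fact10 : (A : Set) (p q : ℕ) → 1 < p → 1 < q → Coprime p q →
         (n : ℕ) → p ⊔ q ≤ n →
         (S : PWord A n) → Special p q S →
         Σ[ X ∈ PWord A n ] (HasPeriod p X × HasPeriod q X ×
           ¬ HasPeriod (gcd p q) X × holes X ≤ holes S)
fact10 A p q 1<p 1<q coprime n p⊔q≤n S (a , b , a≢b , l , sp) =
  S , special⇒period sp , special⇒period (special-swap sp) , no-period-gcd , ≤-refl
  where
  instance
    p≢0 : NonZero p
    p≢0 = >-nonZero (<-trans z<s 1<p)
    q≢0 : NonZero q
    q≢0 = >-nonZero (<-trans z<s 1<q)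

  2≤n : 2 ≤ n
  2≤n = ≤-trans 1<p (≤-trans (m≤m⊔n p q) p⊔q≤n)

  no-period-gcd : ¬ HasPeriod (gcd p q) S
  no-period-gcd period with special-two-letters 1<p 1<q 2≤n sp
  ... | j , S[l]≡b , S[j]≡a =
    a≢b (period1⇒constant S (subst (λ g → HasPeriod g S) (coprime⇒gcd≡1 coprime) period)
                          S[j]≡a S[l]≡b)
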